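{- Let $\mathbb X$ be a gene of length $f\ge 2$ without any occurrence of $\mathbf 0$. Then $\operatorname{Card}\mathcal W(\mathbb X)<\mathrm{Fib}_{f+2}$.
   Context: $(\mathrm{Fib}_i)_{i\ge0}$ is the Fibonacci sequence: $\mathrm{Fib}_0=0$, $\mathrm{Fib}_1=1$, $\mathrm{Fib}_i=\mathrm{Fib}_{i-1}+\mathrm{Fib}_{i-2}$. A gene of length $f$ is a $2f$-periodic sequence $\mathbb{X}=(X_i)_{i\in\mathbb{Z}}$ with values in the set of symbols $\{\mathbf{A},\mathbf{B},\mathbf{AB},\mathbf{0}\}$ such that: (i) if $X_i=\mathbf{AB}$ then $X_{i+1}=\mathbf{0}$; (ii) if $X_i=\mathbf{0}$ then $X_{i-1}\in\{\mathbf{AB},\mathbf{0}\}$; (iii) there exists $i$ with $X_i=\mathbf{0}$ or $X_i\neq X_{i+f}$. (If no $X_i$ is $\mathbf 0$, then all $X_i\in\{\mathbf A,\mathbf B\}$.) Combinatorial weights of such a gene. For a set $W$ of tuples and $c\in\{0,1\}$, $W\times\{c\}$ is the set of tuples obtained by appending $c$. For $\square,\square'\in\{(b,b),(a,b),(b,a)\}$ define $W_i^{\square,\square'}\subset\{0,1\}^{i+1}$ for $-1\le i\le f-1$ by $W_{ -1}^{\square,\square'}=\{()\}$ if $\square=\square'$ and $\emptyset$ otherwise, and for $0\le i\le f-1$: $W_i^{\square,(b,b)}=(W_{i-1}^{\square,(a,b)}\cup W_{i-1}^{\square,(b,a)})\times\{1\}$ if $X_{i-1}=X_{i-1+f}$,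 else $W_{i-1}^{\square,(b,b)}\times\{1\}$; $W_i^{\square,(a,b)}=W_{i-1}^{\square,(a,b)}\times\{0\}$ if $X_i=X_{i-1}$, else $(W_{i-1}^{\square,(b,a)}\cup W_{i-1}^{\square,(b,b)})\times\{0\}$; $W_i^{\square,(b,a)}=W_{i-1}^{\square,(b,a)}\times\{0\}$ if $X_{i+f}=X_{i-1+f}$, else $(W_{i-1}^{\square,(a,b)}\cup W_{i-1}^{\square,(b,b)})\times\{0\}$ (indices of $X$ modulo $2f$). Then $\mathcal W(\mathbb X)=W_{f-1}^{(b,b),(b,b)}\cup W_{f-1}^{(a,b),(b,a)}\cup W_{f-1}^{(b,a),(a,b)}$. -}

module Defs where

open import Data.Nat using (ℕ; zero; suc; _+_; _*_)
open import Data.Integer as ℤ using (ℤ; +_)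
open import Data.Bool using (Bool; true; false; _∧_; _∨_; if_then_else_; not)
open import Data.Vec using (Vec; []; _∷_)
open import Data.List using (List; []; _∷_; map; _++_; filter; length)
open import Data.Product using (_×_; ∃)
open import Relation.Binary.PropositionalEquality using (_≡_; _≢_)
open import Relation.Nullary using (¬_)
open import Data.Sum using (_⊎_)
open import Data.Bool.Properties using (T?)

fib : ℕ → ℕ
fib zero = 0
fib (suc zero) = 1
fib (suc (suc n)) = fib (suc n) + fib n

-- Symbols A, B, AB, 0 (the latter written O)
data Sym : Set where
  A B AB O : Sym

_==_ : Sym → Sym → Bool
A == A = true
B == B = true
AB == AB = true
O == O = true
_ == _ = false

record IsGene (f : ℕ) (X : ℤ → Sym) : Set where
  field
    periodic : ∀ i → X (i ℤ.+ + (2 * f)) ≡ X i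
    condAB   : ∀ i → X i ≡ AB → X (i ℤ.+ + 1) ≡ O
    cond0    : ∀ i → X i ≡ O → (X (i ℤ.- + 1) ≡ AB ⊎ X (i ℤ.- + 1) ≡ O)
    nontriv  : ∃ λ i → X i ≡ O ⊎ X i ≢ X (i ℤ.+ + f)

data Box : Set where
  bb ab ba : Box

-- Membership in W_i^{s,t}, for a tuple of length n = i+1 (so -1 ≤ i).
-- Tuples are stored REVERSED: the head of the vector is the last appended
-- coordinate (the one with index i).
memW : (f : ℕ) (X : ℤ → Sym) (s t : Box) (n : ℕ) → Vec Bool n → Bool
memW f X bb bb zero [] = true
memW f X ab ab zero [] = true
memW f X ba ba zero [] = true
memW f X _  _  zero [] = false
memW f X s bb (suc n) (c ∷ w) =
  c ∧ (if X (+ n ℤ.- + 1) == X (+ n ℤ.- + 1 ℤ.+ + f)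
       then (memW f X s ab n w ∨ memW f X s ba n w)
       else memW f X s bb n w)
memW f X s ab (suc n) (c ∷ w) =
  not c ∧ (if X (+ n) == X (+ n ℤ.- + 1)
           then memW f X s ab n w
           else (memW f X s ba n w ∨ memW f X s bb n w))
memW f X s ba (suc n) (c ∷ w) =
  not c ∧ (if X (+ n ℤ.+ + f) == X (+ n ℤ.- + 1 ℤ.+ + f)
           then memW f X s ba n w
           else (memW f X s ab n w ∨ memW f X s bb n w))

mem𝒲 : (f : ℕ) (X : ℤ → Sym) → Vec Bool f → Bool
mem𝒲 f X w = memW f X bb bb f w ∨ memW f X ab ba f w ∨ memW f X ba ab f w

allVecs : (n : ℕ) → List (Vec Bool n)
allVecs zero = [] ∷ []
allVecs (suc n) = map (true ∷_) (allVecs n) ++ map (false ∷_) (allVecs n)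

card𝒲 : (f : ℕ) (X : ℤ → Sym) → ℕ
card𝒲 f X = length (filter (λ w → T? (mem𝒲 f X w)) (allVecs f))

module Submission where

-- Forgetting which of (a,b), (b,a) a box is, a tuple of 𝒲(X) becomes a closed walk on two
-- states, "the current box is (b,b)" or not, where (b,b) can be entered at step i only from
-- the state opposite to eᵢ = [X_{i-1} = X_{i-1+f}].  Counting closed walks with transfer
-- matrices gives Card 𝒲(X) ≤ tr (M_{e₀} ⋯ M_{e_{f-1}}), with M₁ = [[1,1],[1,0]] the Fibonacci
-- matrix and M₀ = [[1,0],[1,1]].  Right multiplication by M₁ or M₀ maps a row (x, y) to
-- (x + y, x) or (x + y, y), so the rows of a product of m ≥ 1 of them are bounded by (Fib_{m+1}, Fib_m).  If some eᵢ = 0,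
-- rotate M₀ to the end of the product: the trace is at most Fib_f + 2 Fib_{f-1} < Fib_{f+2}
-- when f ≥ 3.  If all eᵢ = 1 the trace is the Lucas number Fib_{f+1} + Fib_{f-1} < Fib_{f+2}.
-- For f = 2 every product except M₁M₁ has trace 2, and e₀ = e₁ = 1 would make X f-periodic,
-- contradicting (iii) as X has no 𝟎.

open import Algebra.Properties.CommutativeSemigroup using (interchange)
open import Data.Bool using (Bool; true; false; not; _∧_; _∨_; _xor_; if_then_else_; T)
open import Data.Bool.Properties using (_≟_; T?; T-≡; T-∧; T-∨)
open import Data.Empty using (⊥-elim)
open import Data.Integer as ℤ using (ℤ; +_; -[1+_])
import Data.Integer.Properties as ℤ
open import Data.List using (List; []; _∷_; _++_; _∷ʳ_; foldr; map; filter; replicate; applyUpTo; length)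
open import Data.List.Properties
  using (length-++; length-++-sucʳ; length-++-comm; ∷ʳ-++; ++-assoc; length-applyUpTo; applyUpTo-∷ʳ)
open import Data.List.Reverse using (Reverse; []; _∶_∶ʳ_; reverseView)
open import Data.Nat using (ℕ; zero; suc; _+_; _*_; _≤_; _<_; z≤n; s≤s; s≤s⁻¹)
open import Data.Nat.Properties
  using ( +-comm; +-assoc; +-identityʳ; *-identityʳ; *-zeroʳ; *-distribʳ-+; +-commutativeSemigroup
        ; ≤-refl; ≤-reflexive; ≤-trans; ≤-<-trans; +-mono-≤; +-monoʳ-<; m≤m+n; m<m+n; module ≤-Reasoning)
open import Data.Nat.Tactic.RingSolver using (solve-∀)
open import Data.Product using (_×_; _,_; ∃₂; ∃-syntax; proj₁; proj₂)
open import Data.Sum using (_⊎_; inj₁; inj₂)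
open import Data.Vec using (Vec; []; _∷_)
open import Function using (_∘_; Equivalence)
open import Relation.Nullary using (¬_; does; contradiction)
open import Relation.Nullary.Decidable using (dec-true)
open import Relation.Binary.PropositionalEquality

open import Defs

data Mat : Set where
  mat : ℕ → ℕ → ℕ → ℕ → Mat

entry : Mat → Bool → Bool → ℕ
entry (mat a b c d) false false = a
entry (mat a b c d) false true  = b
entry (mat a b c d) true  false = c
entry (mat a b c d) true  true  = d

infixl 7 _*ᴹ_

_*ᴹ_ : Mat → Mat → Mat
mat a b c d *ᴹ mat a′ b′ c′ d′ =
  mat (a * a′ + b * c′) (a * b′ + b * d′) (c * a′ + d * c′) (c * b′ + d * d′)

1ᴹ : Mat
1ᴹ = mat 1 0 0 1

trace : Mat → ℕ
trace (mat a b c d) = a + d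

entry-*ᴹ : ∀ A B p q →
           entry (A *ᴹ B) p q ≡ entry A p false * entry B false q + entry A p true * entry B true q
entry-*ᴹ (mat _ _ _ _) (mat _ _ _ _) false false = refl
entry-*ᴹ (mat _ _ _ _) (mat _ _ _ _) false true  = refl
entry-*ᴹ (mat _ _ _ _) (mat _ _ _ _) true  false = refl
entry-*ᴹ (mat _ _ _ _) (mat _ _ _ _) true  true  = refl

trace≡entries : ∀ M → trace M ≡ entry M false false + entry M true true
trace≡entries (mat _ _ _ _) = refl

mat-cong : ∀ {a b c d a′ b′ c′ d′} → a ≡ a′ → b ≡ b′ → c ≡ c′ → d ≡ d′ → mat a b c d ≡ mat a′ b′ c′ d′
mat-cong refl refl refl refl = refl

*ᴹ-assoc : ∀ A B C → A *ᴹ B *ᴹ C ≡ A *ᴹ (B *ᴹ C)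
*ᴹ-assoc (mat a b c d) (mat p q r s) (mat x y z w) =
  mat-cong (assoc a b p q r s x z) (assoc a b p q r s y w) (assoc c d p q r s x z) (assoc c d p q r s y w)
  where
  assoc : ∀ a b p q r s x z →
          (a * p + b * r) * x + (a * q + b * s) * z ≡ a * (p * x + q * z) + b * (r * x + s * z)
  assoc = solve-∀

*ᴹ-identityˡ : ∀ A → 1ᴹ *ᴹ A ≡ A
*ᴹ-identityˡ (mat a b c d) = mat-cong (first a c) (first b d) (second a c) (second b d)
  where
  first : ∀ a c → 1 * a + 0 * c ≡ a
  first = solve-∀
  second : ∀ a c → 0 * a + 1 * c ≡ c
  second = solve-∀

*ᴹ-identityʳ : ∀ A → A *ᴹ 1ᴹ ≡ A
*ᴹ-identityʳ (mat a b c d) = mat-cong (first a b) (second a b) (first c d) (second c d)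
  where
  first : ∀ a b → a * 1 + b * 0 ≡ a
  first = solve-∀
  second : ∀ a b → a * 0 + b * 1 ≡ b
  second = solve-∀

trace-comm : ∀ A B → trace (A *ᴹ B) ≡ trace (B *ᴹ A)
trace-comm (mat a b c d) (mat p q r s) = comm a b c d p q r s
  where
  comm : ∀ a b c d p q r s → (a * p + b * r) + (c * q + d * s) ≡ (p * a + q * c) + (r * b + s * d)
  comm = solve-∀

toℕ : Bool → ℕ
toℕ false = 0
toℕ true  = 1

toℕ-∧ : ∀ a b → toℕ (a ∧ b) ≡ toℕ a * toℕ b
toℕ-∧ false b = refl
toℕ-∧ true  b = sym (+-identityʳ (toℕ b))

toℕ-≤-∨ : ∀ a b c → (T a → T (b ∨ c)) → toℕ a ≤ toℕ b + toℕ c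
toℕ-≤-∨ false _     _     _ = z≤n
toℕ-≤-∨ true  true  _     _ = s≤s z≤n
toℕ-≤-∨ true  false true  _ = s≤s z≤n
toℕ-≤-∨ true  false false h = ⊥-elim (h _)

module _ {A : Set} where

  count : (A → Bool) → List A → ℕ
  count P []       = 0
  count P (x ∷ xs) = toℕ (P x) + count P xs

  length-filter≡count : ∀ P xs → length (filter (λ x → T? (P x)) xs) ≡ count P xs
  length-filter≡count P [] = refl
  length-filter≡count P (x ∷ xs) with P x
  ... | true  = cong suc (length-filter≡count P xs)
  ... | false = length-filter≡count P xs

  count-++ : ∀ P xs ys → count P (xs ++ ys) ≡ count P xs + count P ys
  count-++ P []       ys = refl
  count-++ P (x ∷ xs) ys = trans (cong₂ _+_ refl (count-++ P xs ys)) (sym (+-assoc (toℕ (P x)) _ _))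

  count-∧ʳ : ∀ P b xs → count (λ x → P x ∧ b) xs ≡ count P xs * toℕ b
  count-∧ʳ P b []       = refl
  count-∧ʳ P b (x ∷ xs) =
    trans (cong₂ _+_ (toℕ-∧ (P x) b) (count-∧ʳ P b xs))
          (sym (*-distribʳ-+ (toℕ b) (toℕ (P x)) (count P xs)))

  count-partition : ∀ P Q R → (∀ x → toℕ (P x) ≡ toℕ (Q x) + toℕ (R x)) →
                    ∀ xs → count P xs ≡ count Q xs + count R xs
  count-partition P Q R h []       = refl
  count-partition P Q R h (x ∷ xs) =
    trans (cong₂ _+_ (h x) (count-partition P Q R h xs))
          (interchange +-commutativeSemigroup (toℕ (Q x)) (toℕ (R x)) _ _)

  count-≤-∨ : ∀ P Q R → (∀ x → T (P x) → T (Q x ∨ R x)) →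
              ∀ xs → count P xs ≤ count Q xs + count R xs
  count-≤-∨ P Q R h []       = z≤n
  count-≤-∨ P Q R h (x ∷ xs) =
    ≤-trans (+-mono-≤ (toℕ-≤-∨ (P x) (Q x) (R x) (h x)) (count-≤-∨ P Q R h xs))
            (≤-reflexive (interchange +-commutativeSemigroup (toℕ (Q x)) (toℕ (R x)) _ _))

  count-select : ∀ (P : Bool → A → Bool) q xs →
                 count (λ x → P true x ∧ does (true ≟ q)) xs
                 + count (λ x → P false x ∧ does (false ≟ q)) xs
                 ≡ count (P q) xs
  count-select P true  xs =
    trans (cong₂ _+_ (count-∧ʳ (P true) true xs) (count-∧ʳ (P false) false xs))
          (trans (cong₂ _+_ (*-identityʳ _) (*-zeroʳ (count (P false) xs))) (+-identityʳ _))
  count-select P false xs =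
    trans (cong₂ _+_ (count-∧ʳ (P true) false xs) (count-∧ʳ (P false) true xs))
          (cong₂ _+_ (*-zeroʳ (count (P true) xs)) (*-identityʳ _))

  count-split : ∀ (g P : A → Bool) (h : Bool → Bool) xs →
                count (λ x → P x ∧ h (g x)) xs
                ≡ count (λ x → (P x ∧ does (g x ≟ false)) ∧ h false) xs
                  + count (λ x → (P x ∧ does (g x ≟ true)) ∧ h true) xs
  count-split g P h = count-partition _ _ _ pointwise
    where
    pointwise : ∀ x → toℕ (P x ∧ h (g x))
                      ≡ toℕ ((P x ∧ does (g x ≟ false)) ∧ h false)
                        + toℕ ((P x ∧ does (g x ≟ true)) ∧ h true)
    pointwise x with g x | P x
    ... | false | true  = sym (+-identityʳ _)
    ... | false | false = refl
    ... | true  | true  = refl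
    ... | true  | false = refl

count-map : ∀ {A B : Set} (P : B → Bool) (g : A → B) xs →
            count P (map g xs) ≡ count (λ x → P (g x)) xs
count-map P g []       = refl
count-map P g (x ∷ xs) = cong₂ _+_ refl (count-map P g xs)

count-allVecs-suc : ∀ n (P : Vec Bool (suc n) → Bool) →
                    count P (allVecs (suc n))
                    ≡ count (λ w → P (true ∷ w)) (allVecs n) + count (λ w → P (false ∷ w)) (allVecs n)
count-allVecs-suc n P =
  trans (count-++ P (map (true ∷_) (allVecs n)) _)
        (cong₂ _+_ (count-map P (true ∷_) (allVecs n)) (count-map P (false ∷_) (allVecs n)))

StepRule : Set
StepRule = ℕ → Bool → Bool → Bool

final : ∀ {n} → Bool → Vec Bool n → Bool
final p []      = p
final _ (c ∷ _) = c

-- A vector w = (s_{n-1}, …, s₀) lists the states latest first, as memW does; p is the state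
-- before s₀, and step n goes from s_{n-1} to s_n.
isWalk : StepRule → Bool → (n : ℕ) → Vec Bool n → Bool
isWalk R p zero    []      = true
isWalk R p (suc n) (c ∷ w) = isWalk R p n w ∧ R n (final p w) c

walks : StepRule → Bool → Bool → ℕ → ℕ
walks R p q n = count (λ w → isWalk R p n w ∧ does (final p w ≟ q)) (allVecs n)

toMat : (Bool → Bool → Bool) → Mat
toMat r = mat (toℕ (r false false)) (toℕ (r false true)) (toℕ (r true false)) (toℕ (r true true))

entry-toMat : ∀ r u v → entry (toMat r) u v ≡ toℕ (r u v)
entry-toMat r false false = refl
entry-toMat r false true  = refl
entry-toMat r true  false = refl
entry-toMat r true  true  = refl

walkMatrix : StepRule → ℕ → Mat
walkMatrix R zero    = 1ᴹ
walkMatrix R (suc n) = walkMatrix R n *ᴹ toMat (R n)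

walks≡entry : ∀ R p q n → walks R p q n ≡ entry (walkMatrix R n) p q
walks≡entry R false false zero = refl
walks≡entry R false true  zero = refl
walks≡entry R true  false zero = refl
walks≡entry R true  true  zero = refl
walks≡entry R p q (suc n) = begin
  walks R p q (suc n)
    ≡⟨ count-allVecs-suc n _ ⟩
  count (λ w → (W w ∧ R n (final p w) true) ∧ does (true ≟ q)) V
    + count (λ w → (W w ∧ R n (final p w) false) ∧ does (false ≟ q)) V
    ≡⟨ count-select (λ c w → W w ∧ R n (final p w) c) q V ⟩
  count (λ w → W w ∧ R n (final p w) q) V
    ≡⟨ count-split (final p) W (λ u → R n u q) V ⟩
  count (λ w → (W w ∧ does (final p w ≟ false)) ∧ R n false q) V
    + count (λ w → (W w ∧ does (final p w ≟ true)) ∧ R n true q) V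
    ≡⟨ cong₂ _+_ (count-∧ʳ _ (R n false q) V) (count-∧ʳ _ (R n true q) V) ⟩
  walks R p false n * toℕ (R n false q) + walks R p true n * toℕ (R n true q)
    ≡⟨ cong₂ _+_ (cong₂ _*_ (walks≡entry R p false n) (sym (entry-toMat (R n) false q)))
                 (cong₂ _*_ (walks≡entry R p true n) (sym (entry-toMat (R n) true q))) ⟩
  entry (walkMatrix R n) p false * entry (toMat (R n)) false q
    + entry (walkMatrix R n) p true * entry (toMat (R n)) true q
    ≡⟨ sym (entry-*ᴹ (walkMatrix R n) (toMat (R n)) p q) ⟩
  entry (walkMatrix R (suc n)) p q ∎
  where
  open ≡-Reasoning
  V = allVecs n
  W = isWalk R p n

-- The recursion defining W with the boxes (a,b) and (b,a) merged into the state false: (b,b)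
-- can be entered only from the state not b, where b records whether X_{i-1} = X_{i-1+f}.
allowed : Bool → Bool → Bool → Bool
allowed b u v = not v ∨ (u xor b)

transfer : Bool → Mat
transfer b = toMat (allowed b)

prod : List Bool → Mat
prod = foldr (λ b M → transfer b *ᴹ M) 1ᴹ

prod-++ : ∀ xs ys → prod (xs ++ ys) ≡ prod xs *ᴹ prod ys
prod-++ []       ys = sym (*ᴹ-identityˡ (prod ys))
prod-++ (x ∷ xs) ys =
  trans (cong (transfer x *ᴹ_) (prod-++ xs ys)) (sym (*ᴹ-assoc (transfer x) (prod xs) (prod ys)))

prod-∷ʳ : ∀ xs b → prod (xs ∷ʳ b) ≡ prod xs *ᴹ transfer b
prod-∷ʳ xs b = trans (prod-++ xs (b ∷ [])) (cong (prod xs *ᴹ_) (*ᴹ-identityʳ (transfer b)))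

geneStep : (ℕ → Bool) → StepRule
geneStep e n = allowed (e n)

walkMatrix-geneStep : ∀ e n → walkMatrix (geneStep e) n ≡ prod (applyUpTo e n)
walkMatrix-geneStep e zero    = refl
walkMatrix-geneStep e (suc n) = begin
  walkMatrix (geneStep e) n *ᴹ transfer (e n)  ≡⟨ cong (_*ᴹ transfer (e n)) (walkMatrix-geneStep e n) ⟩
  prod (applyUpTo e n) *ᴹ transfer (e n)       ≡⟨ prod-∷ʳ (applyUpTo e n) (e n) ⟨
  prod (applyUpTo e n ∷ʳ e n)                  ≡⟨ cong prod (applyUpTo-∷ʳ e n) ⟩
  prod (applyUpTo e (suc n))                   ∎
  where open ≡-Reasoning

trace-prod-rotate : ∀ xs ys → trace (prod (xs ++ ys)) ≡ trace (prod (ys ++ xs))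
trace-prod-rotate xs ys = begin
  trace (prod (xs ++ ys))      ≡⟨ cong trace (prod-++ xs ys) ⟩
  trace (prod xs *ᴹ prod ys)   ≡⟨ trace-comm (prod xs) (prod ys) ⟩
  trace (prod ys *ᴹ prod xs)   ≡⟨ cong trace (prod-++ ys xs) ⟨
  trace (prod (ys ++ xs))      ∎
  where open ≡-Reasoning

entry-*ᴹ-transfer-false : ∀ Q b p → entry (Q *ᴹ transfer b) p false ≡ entry Q p false + entry Q p true
entry-*ᴹ-transfer-false Q b p =
  trans (entry-*ᴹ Q (transfer b) p false)
        (cong₂ _+_ (*-identityʳ (entry Q p false)) (*-identityʳ (entry Q p true)))

entry-*ᴹ-transfer-true : ∀ Q b p → entry (Q *ᴹ transfer b) p true ≡ entry Q p (not b)
entry-*ᴹ-transfer-true Q true  p =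
  trans (entry-*ᴹ Q (transfer true) p true)
        (trans (cong₂ _+_ (*-identityʳ _) (*-zeroʳ (entry Q p true))) (+-identityʳ _))
entry-*ᴹ-transfer-true Q false p =
  trans (entry-*ᴹ Q (transfer false) p true) (cong₂ _+_ (*-zeroʳ (entry Q p false)) (*-identityʳ _))

fib-mono-suc : ∀ n → fib n ≤ fib (suc n)
fib-mono-suc zero    = z≤n
fib-mono-suc (suc n) = m≤m+n (fib (suc n)) (fib n)

fib-pos : ∀ n → 1 ≤ fib (suc n)
fib-pos zero    = s≤s z≤n
fib-pos (suc n) = ≤-trans (fib-pos n) (fib-mono-suc (suc n))

fib-<-suc : ∀ {n} → 2 ≤ n → fib n < fib (suc n)
fib-<-suc {suc zero} (s≤s ())
fib-<-suc {suc (suc n)} _ = m<m+n (fib (2 + n)) (fib-pos n)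

RowBound : ℕ → Mat → Set
RowBound m Q = ∀ p → entry Q p false ≤ fib (suc m) × entry Q p true ≤ fib m

rowBound-*ᴹ-transfer : ∀ m Q → RowBound m Q → ∀ b → RowBound (suc m) (Q *ᴹ transfer b)
rowBound-*ᴹ-transfer m Q bound b p with bound p
... | left , right =
  subst (_≤ fib (2 + m)) (sym (entry-*ᴹ-transfer-false Q b p)) (+-mono-≤ left right) ,
  subst (_≤ fib (suc m)) (sym (entry-*ᴹ-transfer-true Q b p)) (second (not b))
  where
  second : ∀ q → entry Q p q ≤ fib (suc m)
  second false = left
  second true  = ≤-trans right (fib-mono-suc m)

rowBound-prod-singleton : ∀ b → RowBound 1 (prod (b ∷ []))
rowBound-prod-singleton true  false = s≤s z≤n , s≤s z≤n
rowBound-prod-singleton true  true  = s≤s z≤n , z≤n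
rowBound-prod-singleton false false = s≤s z≤n , z≤n
rowBound-prod-singleton false true  = s≤s z≤n , s≤s z≤n

length-∷ʳ : ∀ {A : Set} (xs : List A) x → length (xs ∷ʳ x) ≡ suc (length xs)
length-∷ʳ xs x = trans (length-++ xs) (+-comm (length xs) 1)

rowBound-prod-∷ʳ : ∀ {ws} → Reverse ws → ∀ b → RowBound (length (ws ∷ʳ b)) (prod (ws ∷ʳ b))
rowBound-prod-∷ʳ []              b = rowBound-prod-singleton b
rowBound-prod-∷ʳ (vs ∶ rs ∶ʳ v) b =
  subst₂ RowBound (sym (length-∷ʳ (vs ∷ʳ v) b)) (sym (prod-∷ʳ (vs ∷ʳ v) b))
         (rowBound-*ᴹ-transfer (length (vs ∷ʳ v)) (prod (vs ∷ʳ v)) (rowBound-prod-∷ʳ rs v) b)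

rowBound-prod : ∀ ws → 1 ≤ length ws → RowBound (length ws) (prod ws)
rowBound-prod ws nonempty with reverseView ws
... | []             = contradiction nonempty λ ()
... | vs ∶ rs ∶ʳ v = rowBound-prod-∷ʳ rs v

trace-prod-∷ʳ-false< : ∀ ws → 2 ≤ length ws → trace (prod (ws ∷ʳ false)) < fib (3 + length ws)
trace-prod-∷ʳ-false< ws long = begin-strict
  trace (prod (ws ∷ʳ false))
    ≡⟨ cong trace (prod-∷ʳ ws false) ⟩
  trace (Q *ᴹ transfer false)
    ≡⟨ trace≡entries (Q *ᴹ transfer false) ⟩
  entry (Q *ᴹ transfer false) false false + entry (Q *ᴹ transfer false) true true
    ≡⟨ cong₂ _+_ (entry-*ᴹ-transfer-false Q false false) (entry-*ᴹ-transfer-true Q false true) ⟩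
  entry Q false false + entry Q false true + entry Q true true
    ≤⟨ +-mono-≤ (+-mono-≤ (proj₁ (bound false)) (proj₂ (bound false))) (proj₂ (bound true)) ⟩
  fib (suc n) + fib n + fib n
    <⟨ +-monoʳ-< (fib (suc n) + fib n) (fib-<-suc long) ⟩
  fib (3 + n) ∎
  where
  open ≤-Reasoning
  n = length ws
  Q = prod ws
  bound = rowBound-prod ws (≤-trans (s≤s z≤n) long)

prod-replicate-true : ∀ m →
                      prod (replicate (suc m) true) ≡ mat (fib (2 + m)) (fib (1 + m)) (fib (1 + m)) (fib m)
prod-replicate-true zero    = refl
prod-replicate-true (suc m) =
  trans (cong (transfer true *ᴹ_) (prod-replicate-true m))
        (mat-cong (sum (fib (2 + m)) (fib (1 + m))) (sum (fib (1 + m)) (fib m))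
                  (first (fib (2 + m)) (fib (1 + m))) (first (fib (1 + m)) (fib m)))
  where
  sum : ∀ x y → 1 * x + 1 * y ≡ x + y
  sum = solve-∀
  first : ∀ x y → 1 * x + 0 * y ≡ x
  first = solve-∀

trace-prod-replicate-true< : ∀ n → 3 ≤ n → trace (prod (replicate n true)) < fib (2 + n)
trace-prod-replicate-true< (suc zero)       (s≤s ())
trace-prod-replicate-true< (suc (suc zero)) (s≤s (s≤s ()))
trace-prod-replicate-true< (suc (suc (suc k))) _ =
  subst (_< fib (5 + k)) (cong trace (sym (prod-replicate-true (2 + k))))
        (+-monoʳ-< (fib (4 + k)) (fib-<-suc {2 + k} (s≤s (s≤s z≤n))))

trace-prod-false< : ∀ ys zs → 3 ≤ length (ys ++ false ∷ zs) →
                    trace (prod (ys ++ false ∷ zs)) < fib (2 + length (ys ++ false ∷ zs))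
trace-prod-false< ys zs long = begin-strict
  trace (prod (ys ++ false ∷ zs))          ≡⟨ cong (trace ∘ prod) (∷ʳ-++ ys false zs) ⟨
  trace (prod ((ys ∷ʳ false) ++ zs))       ≡⟨ trace-prod-rotate (ys ∷ʳ false) zs ⟩
  trace (prod (zs ++ ys ∷ʳ false))         ≡⟨ cong (trace ∘ prod) (++-assoc zs ys (false ∷ [])) ⟨
  trace (prod (vs ∷ʳ false))               <⟨ trace-prod-∷ʳ-false< vs (s≤s⁻¹ (subst (3 ≤_) len long)) ⟩
  fib (3 + length vs)                      ≡⟨ cong (λ n → fib (2 + n)) len ⟨
  fib (2 + length (ys ++ false ∷ zs))      ∎
  where
  open ≤-Reasoning
  vs = zs ++ ys
  len : length (ys ++ false ∷ zs) ≡ suc (length vs)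
  len = trans (length-++-sucʳ ys false zs) (cong suc (length-++-comm ys zs))

all-true-or-split-false : ∀ ws → ws ≡ replicate (length ws) true ⊎ ∃₂ λ ys zs → ws ≡ ys ++ false ∷ zs
all-true-or-split-false []           = inj₁ refl
all-true-or-split-false (false ∷ ws) = inj₂ ([] , ws , refl)
all-true-or-split-false (true ∷ ws)  with all-true-or-split-false ws
... | inj₁ eq             = inj₁ (cong (true ∷_) eq)
... | inj₂ (ys , zs , eq) = inj₂ (true ∷ ys , zs , cong (true ∷_) eq)

trace-prod< : ∀ ws → 3 ≤ length ws → trace (prod ws) < fib (2 + length ws)
trace-prod< ws long with all-true-or-split-false ws
... | inj₁ eq               = subst (λ vs → trace (prod vs) < fib (2 + length ws)) (sym eq)
                                     (trace-prod-replicate-true< (length ws) long)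
... | inj₂ (ys , zs , refl) = trace-prod-false< ys zs long

shiftMatch : ℕ → (ℤ → Sym) → ℕ → Bool
shiftMatch f X n = X (+ n ℤ.- + 1) == X (+ n ℤ.- + 1 ℤ.+ + f)

isBB : Box → Bool
isBB bb = true
isBB ab = false
isBB ba = false

Predecessor : Bool → (Box → Bool) → Bool → Box → Set
Predecessor b m c t = ∃[ t′ ] T (m t′) × c ≡ isBB t × T (allowed b (isBB t′) (isBB t))

enter-bb : ∀ (m : Box → Bool) c b → T (c ∧ (if b then m ab ∨ m ba else m bb)) → Predecessor b m c bb
enter-bb m true true  h with Equivalence.to T-∨ h
... | inj₁ h′ = ab , h′ , refl , _
... | inj₂ h′ = ba , h′ , refl , _
enter-bb m true false h = bb , h , refl , _

enter-other : ∀ (m : Box → Bool) t₁ t₂ t₃ c b b′ → T (not c ∧ (if b′ then m t₁ else m t₂ ∨ m t₃)) →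
              ∃[ t′ ] T (m t′) × c ≡ false × T (allowed b (isBB t′) false)
enter-other m t₁ t₂ t₃ false b true  h = t₁ , h , refl , _
enter-other m t₁ t₂ t₃ false b false h with Equivalence.to T-∨ h
... | inj₁ h′ = t₂ , h′ , refl , _
... | inj₂ h′ = t₃ , h′ , refl , _

module _ (f : ℕ) (X : ℤ → Sym) where

  memW-nil : ∀ s t → T (memW f X s t 0 []) → s ≡ t
  memW-nil bb bb _ = refl
  memW-nil ab ab _ = refl
  memW-nil ba ba _ = refl
  memW-nil bb ab ()
  memW-nil bb ba ()
  memW-nil ab bb ()
  memW-nil ab ba ()
  memW-nil ba bb ()
  memW-nil ba ab ()

  private
    firstUnchanged secondUnchanged : ℕ → Bool
    firstUnchanged  n = X (+ n) == X (+ n ℤ.- + 1)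
    secondUnchanged n = X (+ n ℤ.+ + f) == X (+ n ℤ.- + 1 ℤ.+ + f)

  previous : Box → (n : ℕ) → Vec Bool n → Box → Bool
  previous s n w t′ = memW f X s t′ n w

  -- memW splits on s before t, so its successor clauses unfold only for concrete s and t.
  memW-suc : ∀ s t n c w → T (memW f X s t (suc n) (c ∷ w)) →
             Predecessor (shiftMatch f X n) (previous s n w) c t
  memW-suc bb bb n c w = enter-bb (previous bb n w) c (shiftMatch f X n)
  memW-suc ab bb n c w = enter-bb (previous ab n w) c (shiftMatch f X n)
  memW-suc ba bb n c w = enter-bb (previous ba n w) c (shiftMatch f X n)
  memW-suc bb ab n c w = enter-other (previous bb n w) ab ba bb c (shiftMatch f X n) (firstUnchanged n)
  memW-suc ab ab n c w = enter-other (previous ab n w) ab ba bb c (shiftMatch f X n) (firstUnchanged n)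
  memW-suc ba ab n c w = enter-other (previous ba n w) ab ba bb c (shiftMatch f X n) (firstUnchanged n)
  memW-suc bb ba n c w = enter-other (previous bb n w) ba ab bb c (shiftMatch f X n) (secondUnchanged n)
  memW-suc ab ba n c w = enter-other (previous ab n w) ba ab bb c (shiftMatch f X n) (secondUnchanged n)
  memW-suc ba ba n c w = enter-other (previous ba n w) ba ab bb c (shiftMatch f X n) (secondUnchanged n)

  memW⇒isWalk : ∀ s t n w → T (memW f X s t n w) →
                T (isWalk (geneStep (shiftMatch f X)) (isBB s) n w) × final (isBB s) w ≡ isBB t
  memW⇒isWalk s t zero    []      h = _ , cong isBB (memW-nil s t h)
  memW⇒isWalk s t (suc n) (c ∷ w) h with memW-suc s t n c w h
  ... | t′ , h′ , refl , step with memW⇒isWalk s t′ n w h′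
  ...   | walk , end =
    Equivalence.from T-∧ (walk , subst (λ u → T (allowed (shiftMatch f X n) u (isBB t))) (sym end) step) , refl

  closedWalk : Bool → Vec Bool f → Bool
  closedWalk p w = isWalk (geneStep (shiftMatch f X)) p f w ∧ does (final p w ≟ p)

  closedWalk-memW : ∀ s t w → isBB s ≡ isBB t → T (memW f X s t f w) → T (closedWalk (isBB s) w)
  closedWalk-memW s t w same h with memW⇒isWalk s t f w h
  ... | walk , end =
    Equivalence.from T-∧ (walk , Equivalence.from T-≡ (dec-true (final (isBB s) w ≟ isBB s) (trans end (sym same))))

  mem𝒲⇒closedWalk : ∀ w → T (mem𝒲 f X w) → T (closedWalk false w ∨ closedWalk true w)
  mem𝒲⇒closedWalk w h with Equivalence.to T-∨ h
  ... | inj₁ h′ = Equivalence.from T-∨ (inj₂ (closedWalk-memW bb bb w refl h′))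
  ... | inj₂ h′ with Equivalence.to T-∨ h′
  ...   | inj₁ h″ = Equivalence.from T-∨ (inj₁ (closedWalk-memW ab ba w refl h″))
  ...   | inj₂ h″ = Equivalence.from T-∨ (inj₁ (closedWalk-memW ba ab w refl h″))

  card𝒲≤trace : card𝒲 f X ≤ trace (prod (applyUpTo (shiftMatch f X) f))
  card𝒲≤trace = begin
    card𝒲 f X
      ≡⟨ length-filter≡count (mem𝒲 f X) (allVecs f) ⟩
    count (mem𝒲 f X) (allVecs f)
      ≤⟨ count-≤-∨ _ _ _ mem𝒲⇒closedWalk (allVecs f) ⟩
    walks R false false f + walks R true true f
      ≡⟨ cong₂ _+_ (walks≡entry R false false f) (walks≡entry R true true f) ⟩
    entry (walkMatrix R f) false false + entry (walkMatrix R f) true true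
      ≡⟨ trace≡entries (walkMatrix R f) ⟨
    trace (walkMatrix R f)
      ≡⟨ cong trace (walkMatrix-geneStep (shiftMatch f X) f) ⟩
    trace (prod (applyUpTo (shiftMatch f X) f)) ∎
    where
    open ≤-Reasoning
    R = geneStep (shiftMatch f X)

==-sound : ∀ a b → T (a == b) → a ≡ b
==-sound A  A  _ = refl
==-sound B  B  _ = refl
==-sound AB AB _ = refl
==-sound O  O  _ = refl
==-sound A  B  ()
==-sound A  AB ()
==-sound A  O  ()
==-sound B  A  ()
==-sound B  AB ()
==-sound B  O  ()
==-sound AB A  ()
==-sound AB B  ()
==-sound AB O  ()
==-sound O  A  ()
==-sound O  B  ()
==-sound O  AB ()

module _ {X : ℤ → Sym} (gene : IsGene 2 X) where

  open IsGene gene using (periodic)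

  HalfPeriodAt : ℤ → Set
  HalfPeriodAt i = X i ≡ X (i ℤ.+ + 2)

  halfPeriod-forward : ∀ i → HalfPeriodAt i → HalfPeriodAt (i ℤ.+ + 2)
  halfPeriod-forward i h = begin
    X (i ℤ.+ + 2)            ≡⟨ h ⟨
    X i                      ≡⟨ periodic i ⟨
    X (i ℤ.+ + 4)            ≡⟨ cong X (ℤ.+-assoc i (+ 2) (+ 2)) ⟨
    X (i ℤ.+ + 2 ℤ.+ + 2)    ∎
    where open ≡-Reasoning

  halfPeriod-backward : ∀ i → HalfPeriodAt (i ℤ.+ + 2) → HalfPeriodAt i
  halfPeriod-backward i h = begin
    X i                      ≡⟨ periodic i ⟨
    X (i ℤ.+ + 4)            ≡⟨ cong X (ℤ.+-assoc i (+ 2) (+ 2)) ⟨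
    X (i ℤ.+ + 2 ℤ.+ + 2)    ≡⟨ h ⟨
    X (i ℤ.+ + 2)            ∎
    where open ≡-Reasoning

  halfPeriod : HalfPeriodAt -[1+ 0 ] → HalfPeriodAt (+ 0) → ∀ i → HalfPeriodAt i
  halfPeriod h₋₁ h₀ = everywhere
    where
    nonneg : ∀ n → HalfPeriodAt (+ n)
    nonneg zero          = h₀
    nonneg (suc zero)    = halfPeriod-forward -[1+ 0 ] h₋₁
    nonneg (suc (suc n)) = subst HalfPeriodAt (ℤ.+-comm (+ n) (+ 2)) (halfPeriod-forward (+ n) (nonneg n))
    neg : ∀ m → HalfPeriodAt -[1+ m ]
    neg zero          = h₋₁
    neg (suc zero)    = halfPeriod-backward -[1+ 1 ] h₀
    neg (suc (suc m)) = halfPeriod-backward -[1+ suc (suc m) ] (neg m)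
    everywhere : ∀ i → HalfPeriodAt i
    everywhere (+ n)    = nonneg n
    everywhere -[1+ m ] = neg m

  shiftMatch-not-both : (∀ i → X i ≢ O) → ¬ (T (shiftMatch 2 X 0) × T (shiftMatch 2 X 1))
  shiftMatch-not-both noO (m₀ , m₁) with IsGene.nontriv gene
  ... | i , inj₁ Xi≡O = noO i Xi≡O
  ... | i , inj₂ Xi≢ = Xi≢ (halfPeriod (==-sound _ _ m₀) (==-sound _ _ m₁) i)

trace-prod-pair< : ∀ a b → ¬ (T a × T b) → trace (prod (a ∷ b ∷ [])) < fib 4
trace-prod-pair< true  true  h = ⊥-elim (h _)
trace-prod-pair< true  false _ = ≤-refl
trace-prod-pair< false true  _ = ≤-refl
trace-prod-pair< false false _ = ≤-refl

theoremA3p1 : (f : ℕ) → 2 ≤ f → (X : ℤ → Sym) → IsGene f X →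
              (∀ i → X i ≢ O) → card𝒲 f X < fib (f + 2)
theoremA3p1 (suc zero) (s≤s ())
theoremA3p1 (suc (suc zero)) _ X gene noO =
  ≤-<-trans (card𝒲≤trace 2 X) (trace-prod-pair< _ _ (shiftMatch-not-both gene noO))
theoremA3p1 f@(suc (suc (suc _))) _ X _ _ = begin-strict
  card𝒲 f X             ≤⟨ card𝒲≤trace f X ⟩
  trace (prod ws)       <⟨ trace-prod< ws (subst (3 ≤_) (sym length≡f) (s≤s (s≤s (s≤s z≤n)))) ⟩
  fib (2 + length ws)   ≡⟨ cong (λ n → fib (2 + n)) length≡f ⟩
  fib (2 + f)           ≡⟨ cong fib (+-comm 2 f) ⟩
  fib (f + 2)           ∎
  where
  open ≤-Reasoning
  ws = applyUpTo (shiftMatch f X) f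
  length≡f : length ws ≡ f
  length≡f = length-applyUpTo (shiftMatch f X) f
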